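{- For every $L_\triangleright$ formula $\varphi$ there exists an $L_\triangleright$ formula $\psi$ not containing the symbol $p$ such that $T^I_\triangleright\vdash\varphi\leftrightarrow\psi$.
   Context: $L_\triangleright$ is the one-sorted first-order language with function symbols $0$ (constant), $s$, $p$ (unary), $+$ (binary, infix) and a binary predicate symbol $\triangleright$ (infix). $T^I_\triangleright$ is the theory with axioms (A1) $\forall x\, sx\neq 0$; (A2) $p0=0$; (A3) $\forall x\, p\,sx=x$; (A4) $\forall x\, x+0=x$; (A5) $\forall x\forall y\, x+sy=s(x+y)$; (A6) $0\triangleright 0$; (A7) $\forall x\forall y\,(x\triangleright y\to sx\triangleright (sx+y))$; (A8) $\forall x\forall y\,(sx\triangleright(sx+y)\to x\triangleright y)$; (A9) $\forall x\forall y\forall z\,(x\triangleright y\wedge x\triangleright z\to y=z)$; (B1) $\forall x\,(x\neq0\to x=s\,p\,x)$; (B2) $\forall x\forall y\, x+y=y+x$; (B3) $\forall x\forall y\forall z\,(x+y)+z=x+(y+z)$; (B4) $\forall x\forall y\forall z\,(x+y=x+z\to y=z)$. -}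

module Defs where

open import Data.Nat using (ℕ; zero; suc)
open import Data.List using (List; []; _∷_; map)
open import Data.List.Membership.Propositional using (_∈_)
open import Data.List.Relation.Unary.All using (All)
open import Data.Product using (Σ; _×_)

infixl 8 _⊕_
data Term : Set where
  var  : ℕ → Term
  𝟎    : Term
  S    : Term → Term
  P    : Term → Term
  _⊕_  : Term → Term → Term

infix 6 _≐_ _⊳_
infixl 5 _∧'_
infixl 4 _∨'_
infixr 3 _⇛_
data Form : Set where
  Bot  : Form
  _≐_  : Term → Term → Form
  _⊳_  : Term → Term → Form
  _⇛_  : Form → Form → Form
  _∧'_ : Form → Form → Form
  _∨'_ : Form → Form → Form
  Fall : Form → Form          -- ∀ (binds de Bruijn index 0)
  Ex   : Form → Form          -- ∃ (binds de Bruijn index 0)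

Neg : Form → Form
Neg φ = φ ⇛ Bot

infix 2 _⇔'_
_⇔'_ : Form → Form → Form
φ ⇔' ψ = (φ ⇛ ψ) ∧' (ψ ⇛ φ)

data NoPT : Term → Set where
  var : ∀ n → NoPT (var n)
  𝟎   : NoPT 𝟎
  S   : ∀ {t} → NoPT t → NoPT (S t)
  _⊕_ : ∀ {t u} → NoPT t → NoPT u → NoPT (t ⊕ u)

data NoP : Form → Set where
  Bot  : NoP Bot
  _≐_  : ∀ {t u} → NoPT t → NoPT u → NoP (t ≐ u)
  _⊳_  : ∀ {t u} → NoPT t → NoPT u → NoP (t ⊳ u)
  _⇛_  : ∀ {φ ψ} → NoP φ → NoP ψ → NoP (φ ⇛ ψ)
  _∧'_ : ∀ {φ ψ} → NoP φ → NoP ψ → NoP (φ ∧' ψ)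
  _∨'_ : ∀ {φ ψ} → NoP φ → NoP ψ → NoP (φ ∨' ψ)
  Fall : ∀ {φ} → NoP φ → NoP (Fall φ)
  Ex   : ∀ {φ} → NoP φ → NoP (Ex φ)

liftR : (ℕ → ℕ) → ℕ → ℕ
liftR ρ zero    = zero
liftR ρ (suc n) = suc (ρ n)

renT : (ℕ → ℕ) → Term → Term
renT ρ (var n) = var (ρ n)
renT ρ 𝟎       = 𝟎
renT ρ (S t)   = S (renT ρ t)
renT ρ (P t)   = P (renT ρ t)
renT ρ (t ⊕ u) = renT ρ t ⊕ renT ρ u

renF : (ℕ → ℕ) → Form → Form
renF ρ Bot      = Bot
renF ρ (t ≐ u)  = renT ρ t ≐ renT ρ u
renF ρ (t ⊳ u)  = renT ρ t ⊳ renT ρ u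
renF ρ (φ ⇛ ψ)  = renF ρ φ ⇛ renF ρ ψ
renF ρ (φ ∧' ψ) = renF ρ φ ∧' renF ρ ψ
renF ρ (φ ∨' ψ) = renF ρ φ ∨' renF ρ ψ
renF ρ (Fall φ) = Fall (renF (liftR ρ) φ)
renF ρ (Ex φ)   = Ex (renF (liftR ρ) φ)

shift : Form → Form
shift = renF suc

liftS : (ℕ → Term) → ℕ → Term
liftS σ zero    = var zero
liftS σ (suc n) = renT suc (σ n)

subT : (ℕ → Term) → Term → Term
subT σ (var n) = σ n
subT σ 𝟎       = 𝟎
subT σ (S t)   = S (subT σ t)
subT σ (P t)   = P (subT σ t)
subT σ (t ⊕ u) = subT σ t ⊕ subT σ u

subF : (ℕ → Term) → Form → Form
subF σ Bot      = Bot
subF σ (t ≐ u)  = subT σ t ≐ subT σ u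
subF σ (t ⊳ u)  = subT σ t ⊳ subT σ u
subF σ (φ ⇛ ψ)  = subF σ φ ⇛ subF σ ψ
subF σ (φ ∧' ψ) = subF σ φ ∧' subF σ ψ
subF σ (φ ∨' ψ) = subF σ φ ∨' subF σ ψ
subF σ (Fall φ) = Fall (subF (liftS σ) φ)
subF σ (Ex φ)   = Ex (subF (liftS σ) φ)

sub0 : Term → ℕ → Term
sub0 t zero    = t
sub0 t (suc n) = var n

_[_] : Form → Term → Form
φ [ t ] = subF (sub0 t) φ

infix 1 _⊢_
data _⊢_ (Γ : List Form) : Form → Set where
  ax    : ∀ {φ} → φ ∈ Γ → Γ ⊢ φ
  raa   : ∀ {φ} → (Neg φ ∷ Γ) ⊢ Bot → Γ ⊢ φ
  ⇛I    : ∀ {φ ψ} → (φ ∷ Γ) ⊢ ψ → Γ ⊢ φ ⇛ ψ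
  ⇛E    : ∀ {φ ψ} → Γ ⊢ φ ⇛ ψ → Γ ⊢ φ → Γ ⊢ ψ
  ∧I    : ∀ {φ ψ} → Γ ⊢ φ → Γ ⊢ ψ → Γ ⊢ φ ∧' ψ
  ∧E₁   : ∀ {φ ψ} → Γ ⊢ φ ∧' ψ → Γ ⊢ φ
  ∧E₂   : ∀ {φ ψ} → Γ ⊢ φ ∧' ψ → Γ ⊢ ψ
  ∨I₁   : ∀ {φ ψ} → Γ ⊢ φ → Γ ⊢ φ ∨' ψ
  ∨I₂   : ∀ {φ ψ} → Γ ⊢ ψ → Γ ⊢ φ ∨' ψ
  ∨E    : ∀ {φ ψ χ} → Γ ⊢ φ ∨' ψ → (φ ∷ Γ) ⊢ χ → (ψ ∷ Γ) ⊢ χ → Γ ⊢ χ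
  FallI : ∀ {φ} → map shift Γ ⊢ φ → Γ ⊢ Fall φ
  FallE : ∀ {φ} (t : Term) → Γ ⊢ Fall φ → Γ ⊢ φ [ t ]
  ExI   : ∀ {φ} (t : Term) → Γ ⊢ φ [ t ] → Γ ⊢ Ex φ
  ExE   : ∀ {φ ψ} → Γ ⊢ Ex φ → (φ ∷ map shift Γ) ⊢ shift ψ → Γ ⊢ ψ
  ≐refl : ∀ (t : Term) → Γ ⊢ t ≐ t
  ≐E    : ∀ {φ t u} → Γ ⊢ t ≐ u → Γ ⊢ φ [ t ] → Γ ⊢ φ [ u ]

private
  x₁ x₂ y₂ x₃ y₃ z₃ : Term
  x₁ = var 0
  x₂ = var 1
  y₂ = var 0
  x₃ = var 2
  y₃ = var 1
  z₃ = var 0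

data AxiomTI : Form → Set where
  A1 : AxiomTI (Fall (Neg (S x₁ ≐ 𝟎)))
  A2 : AxiomTI (P 𝟎 ≐ 𝟎)
  A3 : AxiomTI (Fall (P (S x₁) ≐ x₁))
  A4 : AxiomTI (Fall (x₁ ⊕ 𝟎 ≐ x₁))
  A5 : AxiomTI (Fall (Fall (x₂ ⊕ S y₂ ≐ S (x₂ ⊕ y₂))))
  A6 : AxiomTI (𝟎 ⊳ 𝟎)
  A7 : AxiomTI (Fall (Fall (x₂ ⊳ y₂ ⇛ S x₂ ⊳ (S x₂ ⊕ y₂))))
  A8 : AxiomTI (Fall (Fall (S x₂ ⊳ (S x₂ ⊕ y₂) ⇛ x₂ ⊳ y₂)))
  A9 : AxiomTI (Fall (Fall (Fall ((x₃ ⊳ y₃ ∧' x₃ ⊳ z₃) ⇛ y₃ ≐ z₃))))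
  B1 : AxiomTI (Fall (Neg (x₁ ≐ 𝟎) ⇛ x₁ ≐ S (P x₁)))
  B2 : AxiomTI (Fall (Fall (x₂ ⊕ y₂ ≐ y₂ ⊕ x₂)))
  B3 : AxiomTI (Fall (Fall (Fall ((x₃ ⊕ y₃) ⊕ z₃ ≐ x₃ ⊕ (y₃ ⊕ z₃)))))
  B4 : AxiomTI (Fall (Fall (Fall (x₃ ⊕ y₃ ≐ x₃ ⊕ z₃ ⇛ y₃ ≐ z₃))))

TI⊢_ : Form → Set
TI⊢ φ = Σ (List Form) λ Γ → All AxiomTI Γ × (Γ ⊢ φ)

-- Every term t has a p-free "graph" formula expressing v = t: the value of
-- p c is the unique y with (c = 0 ∧ y = 0) ∨ c = s y, which A2, A3 and B1
-- justify, and a compound term is unfolded by naming the values of its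
-- immediate subterms with existential quantifiers.  Replacing each atom
-- R t u by ∃x ∃y (x = t ∧ y = u ∧ R x y), with the equations written as
-- graphs, yields an equivalent p-free formula, since provable equivalence
-- is a congruence for all connectives and quantifiers.
module Submission where

open import Defs
open import Data.Nat using (ℕ; zero; suc)
open import Data.Product using (Σ; _×_; _,_)
open import Data.List using (List; []; _∷_; map)
open import Data.List.Relation.Unary.Any using (here; there)
open import Data.List.Relation.Unary.All using (All; []; _∷_)
open import Data.List.Relation.Binary.Subset.Propositional using (_⊆_)
open import Data.List.Relation.Binary.Subset.Propositional.Properties
  using (⊆-reflexive; map⁺; ∷⁺ʳ)
open import Function using (_∘_; id)
open import Relation.Binary.PropositionalEquality hiding ([_])

liftS-cong : ∀ {σ τ} → σ ≗ τ → liftS σ ≗ liftS τ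
liftS-cong e zero    = refl
liftS-cong e (suc n) = cong (renT suc) (e n)

subT-cong : ∀ {σ τ} → σ ≗ τ → ∀ t → subT σ t ≡ subT τ t
subT-cong e (var n) = e n
subT-cong e 𝟎       = refl
subT-cong e (S t)   = cong S (subT-cong e t)
subT-cong e (P t)   = cong P (subT-cong e t)
subT-cong e (t ⊕ u) = cong₂ _⊕_ (subT-cong e t) (subT-cong e u)

subF-cong : ∀ {σ τ} → σ ≗ τ → ∀ φ → subF σ φ ≡ subF τ φ
subF-cong e Bot      = refl
subF-cong e (t ≐ u)  = cong₂ _≐_ (subT-cong e t) (subT-cong e u)
subF-cong e (t ⊳ u)  = cong₂ _⊳_ (subT-cong e t) (subT-cong e u)
subF-cong e (φ ⇛ ψ)  = cong₂ _⇛_ (subF-cong e φ) (subF-cong e ψ)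
subF-cong e (φ ∧' ψ) = cong₂ _∧'_ (subF-cong e φ) (subF-cong e ψ)
subF-cong e (φ ∨' ψ) = cong₂ _∨'_ (subF-cong e φ) (subF-cong e ψ)
subF-cong e (Fall φ) = cong Fall (subF-cong (liftS-cong e) φ)
subF-cong e (Ex φ)   = cong Ex (subF-cong (liftS-cong e) φ)

subT-var : ∀ t → subT var t ≡ t
subT-var (var n) = refl
subT-var 𝟎       = refl
subT-var (S t)   = cong S (subT-var t)
subT-var (P t)   = cong P (subT-var t)
subT-var (t ⊕ u) = cong₂ _⊕_ (subT-var t) (subT-var u)

liftS-var : liftS var ≗ var
liftS-var zero    = refl
liftS-var (suc n) = refl

subF-var : ∀ φ → subF var φ ≡ φ
subF-var Bot      = refl
subF-var (t ≐ u)  = cong₂ _≐_ (subT-var t) (subT-var u)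
subF-var (t ⊳ u)  = cong₂ _⊳_ (subT-var t) (subT-var u)
subF-var (φ ⇛ ψ)  = cong₂ _⇛_ (subF-var φ) (subF-var ψ)
subF-var (φ ∧' ψ) = cong₂ _∧'_ (subF-var φ) (subF-var ψ)
subF-var (φ ∨' ψ) = cong₂ _∨'_ (subF-var φ) (subF-var ψ)
subF-var (Fall φ) = cong Fall (trans (subF-cong liftS-var φ) (subF-var φ))
subF-var (Ex φ)   = cong Ex (trans (subF-cong liftS-var φ) (subF-var φ))

renT-as-subT : ∀ ρ t → renT ρ t ≡ subT (var ∘ ρ) t
renT-as-subT ρ (var n) = refl
renT-as-subT ρ 𝟎       = refl
renT-as-subT ρ (S t)   = cong S (renT-as-subT ρ t)
renT-as-subT ρ (P t)   = cong P (renT-as-subT ρ t)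
renT-as-subT ρ (t ⊕ u) = cong₂ _⊕_ (renT-as-subT ρ t) (renT-as-subT ρ u)

liftR-as-liftS : ∀ ρ → var ∘ liftR ρ ≗ liftS (var ∘ ρ)
liftR-as-liftS ρ zero    = refl
liftR-as-liftS ρ (suc n) = refl

renF-as-subF : ∀ ρ φ → renF ρ φ ≡ subF (var ∘ ρ) φ
renF-as-subF ρ Bot      = refl
renF-as-subF ρ (t ≐ u)  = cong₂ _≐_ (renT-as-subT ρ t) (renT-as-subT ρ u)
renF-as-subF ρ (t ⊳ u)  = cong₂ _⊳_ (renT-as-subT ρ t) (renT-as-subT ρ u)
renF-as-subF ρ (φ ⇛ ψ)  = cong₂ _⇛_ (renF-as-subF ρ φ) (renF-as-subF ρ ψ)
renF-as-subF ρ (φ ∧' ψ) = cong₂ _∧'_ (renF-as-subF ρ φ) (renF-as-subF ρ ψ)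
renF-as-subF ρ (φ ∨' ψ) = cong₂ _∨'_ (renF-as-subF ρ φ) (renF-as-subF ρ ψ)
renF-as-subF ρ (Fall φ) =
  cong Fall (trans (renF-as-subF (liftR ρ) φ) (subF-cong (liftR-as-liftS ρ) φ))
renF-as-subF ρ (Ex φ)   =
  cong Ex (trans (renF-as-subF (liftR ρ) φ) (subF-cong (liftR-as-liftS ρ) φ))

subT-subT : ∀ σ τ t → subT σ (subT τ t) ≡ subT (subT σ ∘ τ) t
subT-subT σ τ (var n) = refl
subT-subT σ τ 𝟎       = refl
subT-subT σ τ (S t)   = cong S (subT-subT σ τ t)
subT-subT σ τ (P t)   = cong P (subT-subT σ τ t)
subT-subT σ τ (t ⊕ u) = cong₂ _⊕_ (subT-subT σ τ t) (subT-subT σ τ u)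

subT-renT : ∀ σ ρ t → subT σ (renT ρ t) ≡ subT (σ ∘ ρ) t
subT-renT σ ρ t = trans (cong (subT σ) (renT-as-subT ρ t)) (subT-subT σ (var ∘ ρ) t)

renT-subT : ∀ ρ σ t → renT ρ (subT σ t) ≡ subT (renT ρ ∘ σ) t
renT-subT ρ σ t = begin
  renT ρ (subT σ t)               ≡⟨ renT-as-subT ρ (subT σ t) ⟩
  subT (var ∘ ρ) (subT σ t)       ≡⟨ subT-subT (var ∘ ρ) σ t ⟩
  subT (subT (var ∘ ρ) ∘ σ) t     ≡⟨ subT-cong (sym ∘ renT-as-subT ρ ∘ σ) t ⟩
  subT (renT ρ ∘ σ) t             ∎
  where open ≡-Reasoning

renT-renT : ∀ ρ ρ′ t → renT ρ (renT ρ′ t) ≡ renT (ρ ∘ ρ′) t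
renT-renT ρ ρ′ t = begin
  renT ρ (renT ρ′ t)              ≡⟨ renT-as-subT ρ (renT ρ′ t) ⟩
  subT (var ∘ ρ) (renT ρ′ t)      ≡⟨ subT-renT (var ∘ ρ) ρ′ t ⟩
  subT (var ∘ ρ ∘ ρ′) t           ≡⟨ renT-as-subT (ρ ∘ ρ′) t ⟨
  renT (ρ ∘ ρ′) t                 ∎
  where open ≡-Reasoning

renT-id : ∀ t → renT id t ≡ t
renT-id t = trans (renT-as-subT id t) (subT-var t)

subT-sub0-renT-suc : ∀ a t → subT (sub0 a) (renT suc t) ≡ t
subT-sub0-renT-suc a t = trans (subT-renT (sub0 a) suc t) (subT-var t)

liftS-subT : ∀ σ τ → subT (liftS σ) ∘ liftS τ ≗ liftS (subT σ ∘ τ)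
liftS-subT σ τ zero    = refl
liftS-subT σ τ (suc n) = trans (subT-renT (liftS σ) suc (τ n)) (sym (renT-subT suc σ (τ n)))

subF-subF : ∀ σ τ φ → subF σ (subF τ φ) ≡ subF (subT σ ∘ τ) φ
subF-subF σ τ Bot      = refl
subF-subF σ τ (t ≐ u)  = cong₂ _≐_ (subT-subT σ τ t) (subT-subT σ τ u)
subF-subF σ τ (t ⊳ u)  = cong₂ _⊳_ (subT-subT σ τ t) (subT-subT σ τ u)
subF-subF σ τ (φ ⇛ ψ)  = cong₂ _⇛_ (subF-subF σ τ φ) (subF-subF σ τ ψ)
subF-subF σ τ (φ ∧' ψ) = cong₂ _∧'_ (subF-subF σ τ φ) (subF-subF σ τ ψ)
subF-subF σ τ (φ ∨' ψ) = cong₂ _∨'_ (subF-subF σ τ φ) (subF-subF σ τ ψ)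
subF-subF σ τ (Fall φ) =
  cong Fall (trans (subF-subF (liftS σ) (liftS τ) φ) (subF-cong (liftS-subT σ τ) φ))
subF-subF σ τ (Ex φ)   =
  cong Ex (trans (subF-subF (liftS σ) (liftS τ) φ) (subF-cong (liftS-subT σ τ) φ))

subF-renF : ∀ σ ρ φ → subF σ (renF ρ φ) ≡ subF (σ ∘ ρ) φ
subF-renF σ ρ φ = trans (cong (subF σ) (renF-as-subF ρ φ)) (subF-subF σ (var ∘ ρ) φ)

renF-liftR-suc-inst-var0 : ∀ φ → renF (liftR suc) φ [ var 0 ] ≡ φ
renF-liftR-suc-inst-var0 φ = begin
  renF (liftR suc) φ [ var 0 ]          ≡⟨ subF-renF (sub0 (var 0)) (liftR suc) φ ⟩
  subF (sub0 (var 0) ∘ liftR suc) φ     ≡⟨ subF-cong (λ { zero → refl ; (suc n) → refl }) φ ⟩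
  subF var φ                            ≡⟨ subF-var φ ⟩
  φ                                     ∎
  where open ≡-Reasoning

renF-liftR-inst : ∀ ρ a φ → renF (liftR ρ) φ [ renT ρ a ] ≡ renF ρ (φ [ a ])
renF-liftR-inst ρ a φ = begin
  renF (liftR ρ) φ [ renT ρ a ]             ≡⟨ subF-renF (sub0 (renT ρ a)) (liftR ρ) φ ⟩
  subF (sub0 (renT ρ a) ∘ liftR ρ) φ        ≡⟨ subF-cong pointwise φ ⟩
  subF (subT (var ∘ ρ) ∘ sub0 a) φ          ≡⟨ subF-subF (var ∘ ρ) (sub0 a) φ ⟨
  subF (var ∘ ρ) (φ [ a ])                  ≡⟨ renF-as-subF ρ (φ [ a ]) ⟨
  renF ρ (φ [ a ])                          ∎
  where
  open ≡-Reasoning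
  pointwise : sub0 (renT ρ a) ∘ liftR ρ ≗ subT (var ∘ ρ) ∘ sub0 a
  pointwise zero    = renT-as-subT ρ a
  pointwise (suc n) = refl

weaken : ∀ {Γ Δ φ} → Γ ⊆ Δ → Γ ⊢ φ → Δ ⊢ φ
weaken s (ax i)      = ax (s i)
weaken s (raa d)     = raa (weaken (∷⁺ʳ _ s) d)
weaken s (⇛I d)      = ⇛I (weaken (∷⁺ʳ _ s) d)
weaken s (⇛E d e)    = ⇛E (weaken s d) (weaken s e)
weaken s (∧I d e)    = ∧I (weaken s d) (weaken s e)
weaken s (∧E₁ d)     = ∧E₁ (weaken s d)
weaken s (∧E₂ d)     = ∧E₂ (weaken s d)
weaken s (∨I₁ d)     = ∨I₁ (weaken s d)
weaken s (∨I₂ d)     = ∨I₂ (weaken s d)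
weaken s (∨E d e f)  = ∨E (weaken s d) (weaken (∷⁺ʳ _ s) e) (weaken (∷⁺ʳ _ s) f)
weaken s (FallI d)   = FallI (weaken (map⁺ shift s) d)
weaken s (FallE t d) = FallE t (weaken s d)
weaken s (ExI t d)   = ExI t (weaken s d)
weaken s (ExE d e)   = ExE (weaken s d) (weaken (∷⁺ʳ _ (map⁺ shift s)) e)
weaken s (≐refl t)   = ≐refl t
weaken s (≐E d e)    = ≐E (weaken s d) (weaken s e)

weaken₁ : ∀ {Γ φ ψ} → Γ ⊢ φ → ψ ∷ Γ ⊢ φ
weaken₁ = weaken there

weaken₂ : ∀ {Γ φ ψ χ} → Γ ⊢ φ → ψ ∷ χ ∷ Γ ⊢ φ
weaken₂ = weaken₁ ∘ weaken₁

hyp : ∀ {Γ φ} → φ ∷ Γ ⊢ φ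
hyp = ax (here refl)

excluded-middle : ∀ {Γ φ} → Γ ⊢ φ ∨' Neg φ
excluded-middle = raa (⇛E hyp (∨I₂ (⇛I (⇛E (weaken₁ hyp) (∨I₁ hyp)))))

≐-elim : ∀ {Γ} φ {a b A B} → φ [ a ] ≡ A → φ [ b ] ≡ B → Γ ⊢ a ≐ b → Γ ⊢ A → Γ ⊢ B
≐-elim φ refl refl = ≐E {φ = φ}

≐-sym : ∀ {Γ a b} → Γ ⊢ a ≐ b → Γ ⊢ b ≐ a
≐-sym {a = a} {b} d =
  ≐-elim (var 0 ≐ renT suc a)
    (cong (a ≐_) (subT-sub0-renT-suc a a)) (cong (b ≐_) (subT-sub0-renT-suc b a)) d (≐refl a)

≐-trans : ∀ {Γ a b c} → Γ ⊢ a ≐ b → Γ ⊢ b ≐ c → Γ ⊢ a ≐ c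
≐-trans {a = a} {b} {c} d e =
  ≐-elim (renT suc a ≐ var 0)
    (cong (_≐ b) (subT-sub0-renT-suc b a)) (cong (_≐ c) (subT-sub0-renT-suc c a)) e d

≐-cong : ∀ {Γ a b} (f : Term → Term) → (∀ σ t → subT σ (f t) ≡ f (subT σ t)) →
         Γ ⊢ a ≐ b → Γ ⊢ f a ≐ f b
≐-cong {a = a} {b} f f-sub d =
  ≐-elim (f (renT suc a) ≐ f (var 0)) (eq a) (eq b) d (≐refl (f a))
  where
  eq : ∀ c → (f (renT suc a) ≐ f (var 0)) [ c ] ≡ (f a ≐ f c)
  eq c = cong₂ _≐_ (trans (f-sub (sub0 c) (renT suc a)) (cong f (subT-sub0-renT-suc c a)))
                   (f-sub (sub0 c) (var 0))

⇔-to : ∀ {Γ φ ψ} → Γ ⊢ φ ⇔' ψ → Γ ⊢ φ → Γ ⊢ ψ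
⇔-to d = ⇛E (∧E₁ d)

⇔-from : ∀ {Γ φ ψ} → Γ ⊢ φ ⇔' ψ → Γ ⊢ ψ → Γ ⊢ φ
⇔-from d = ⇛E (∧E₂ d)

⇔-refl : ∀ {Γ φ} → Γ ⊢ φ ⇔' φ
⇔-refl = ∧I (⇛I hyp) (⇛I hyp)

⇔-sym : ∀ {Γ φ ψ} → Γ ⊢ φ ⇔' ψ → Γ ⊢ ψ ⇔' φ
⇔-sym d = ∧I (∧E₂ d) (∧E₁ d)

⇔-trans : ∀ {Γ φ ψ χ} → Γ ⊢ φ ⇔' ψ → Γ ⊢ ψ ⇔' χ → Γ ⊢ φ ⇔' χ
⇔-trans d e = ∧I (⇛I (⇔-to (weaken₁ e) (⇔-to (weaken₁ d) hyp)))
                 (⇛I (⇔-from (weaken₁ d) (⇔-from (weaken₁ e) hyp)))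

⇔-≡ : ∀ {Γ φ ψ χ} → Γ ⊢ φ ⇔' ψ → ψ ≡ χ → Γ ⊢ φ ⇔' χ
⇔-≡ d refl = d

⇛-cong : ∀ {Γ φ φ′ ψ ψ′} → Γ ⊢ φ ⇔' φ′ → Γ ⊢ ψ ⇔' ψ′ → Γ ⊢ (φ ⇛ ψ) ⇔' (φ′ ⇛ ψ′)
⇛-cong d e =
  ∧I (⇛I (⇛I (⇔-to (weaken₂ e) (⇛E (weaken₁ hyp) (⇔-from (weaken₂ d) hyp)))))
     (⇛I (⇛I (⇔-from (weaken₂ e) (⇛E (weaken₁ hyp) (⇔-to (weaken₂ d) hyp)))))

∧-cong : ∀ {Γ φ φ′ ψ ψ′} → Γ ⊢ φ ⇔' φ′ → Γ ⊢ ψ ⇔' ψ′ → Γ ⊢ (φ ∧' ψ) ⇔' (φ′ ∧' ψ′)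
∧-cong d e =
  ∧I (⇛I (∧I (⇔-to (weaken₁ d) (∧E₁ hyp)) (⇔-to (weaken₁ e) (∧E₂ hyp))))
     (⇛I (∧I (⇔-from (weaken₁ d) (∧E₁ hyp)) (⇔-from (weaken₁ e) (∧E₂ hyp))))

∨-cong : ∀ {Γ φ φ′ ψ ψ′} → Γ ⊢ φ ⇔' φ′ → Γ ⊢ ψ ⇔' ψ′ → Γ ⊢ (φ ∨' ψ) ⇔' (φ′ ∨' ψ′)
∨-cong d e =
  ∧I (⇛I (∨E hyp (∨I₁ (⇔-to (weaken₂ d) hyp)) (∨I₂ (⇔-to (weaken₂ e) hyp))))
     (⇛I (∨E hyp (∨I₁ (⇔-from (weaken₂ d) hyp)) (∨I₂ (⇔-from (weaken₂ e) hyp))))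

-- Γ-closed holds for any context of sentences, in particular by refl for Γₚ below.
module _ {Γ : List Form} (Γ-closed : map shift Γ ≡ Γ) where

  private
    Γ⊆shiftΓ : Γ ⊆ map shift Γ
    Γ⊆shiftΓ = ⊆-reflexive (sym Γ-closed)

  Fall-mono : ∀ {φ ψ} → Γ ⊢ φ ⇛ ψ → Γ ⊢ Fall φ ⇛ Fall ψ
  Fall-mono {φ} d = ⇛I (FallI (⇛E (weaken (there ∘ Γ⊆shiftΓ) d) φ-at-var0))
    where
    φ-at-var0 : shift (Fall φ) ∷ map shift Γ ⊢ φ
    φ-at-var0 = subst (shift (Fall φ) ∷ map shift Γ ⊢_) (renF-liftR-suc-inst-var0 φ)
                      (FallE (var 0) hyp)

  Ex-mono : ∀ {φ ψ} → Γ ⊢ φ ⇛ ψ → Γ ⊢ Ex φ ⇛ Ex ψ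
  Ex-mono {ψ = ψ} d = ⇛I (ExE hyp (ExI (var 0)
    (subst (_ ⊢_) (sym (renF-liftR-suc-inst-var0 ψ))
      (⇛E (weaken (there ∘ there ∘ Γ⊆shiftΓ) d) hyp))))

  Fall-cong : ∀ {φ ψ} → Γ ⊢ φ ⇔' ψ → Γ ⊢ Fall φ ⇔' Fall ψ
  Fall-cong d = ∧I (Fall-mono (∧E₁ d)) (Fall-mono (∧E₂ d))

  Ex-cong : ∀ {φ ψ} → Γ ⊢ φ ⇔' ψ → Γ ⊢ Ex φ ⇔' Ex ψ
  Ex-cong d = ∧I (Ex-mono (∧E₁ d)) (Ex-mono (∧E₂ d))

  one-point : ∀ {A} B a → Γ ⊢ A ⇔' (var 0 ≐ renT suc a) → Γ ⊢ Ex (A ∧' B) ⇔' B [ a ]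
  one-point {A} B a A⇔x≐a = ∧I (⇛I (ExE hyp B[a]↑)) (⇛I (ExI a (∧I (weaken₁ A[a]) hyp)))
    where
    B[a]↑ : (A ∧' B) ∷ map shift (Ex (A ∧' B) ∷ Γ) ⊢ shift (B [ a ])
    B[a]↑ = ≐-elim (renF (liftR suc) B)
      (renF-liftR-suc-inst-var0 B) (renF-liftR-inst suc a B)
      (⇔-to (weaken (there ∘ there ∘ Γ⊆shiftΓ) A⇔x≐a) (∧E₁ hyp)) (∧E₂ hyp)
    A[a] : Γ ⊢ A [ a ]
    A[a] = ⇔-from (⇔-≡ (FallE a (FallI (weaken Γ⊆shiftΓ A⇔x≐a)))
                       (cong (a ≐_) (subT-sub0-renT-suc a a)))
                  (≐refl a)

Γₚ : List Form
Γₚ = P 𝟎 ≐ 𝟎 ∷ Fall (P (S (var 0)) ≐ var 0) ∷ Fall (Neg (var 0 ≐ 𝟎) ⇛ var 0 ≐ S (P (var 0))) ∷ []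

Γₚ-axioms : All AxiomTI Γₚ
Γₚ-axioms = A2 ∷ A3 ∷ B1 ∷ []

ax-A2 : Γₚ ⊢ P 𝟎 ≐ 𝟎
ax-A2 = ax (here refl)

ax-A3 : ∀ y → Γₚ ⊢ P (S y) ≐ y
ax-A3 y = FallE y (ax (there (here refl)))

ax-B1 : ∀ c → Γₚ ⊢ Neg (c ≐ 𝟎) ⇛ c ≐ S (P c)
ax-B1 c = FallE c (ax (there (there (here refl))))

≐P-char : ∀ c y → Γₚ ⊢ ((c ≐ 𝟎 ∧' y ≐ 𝟎) ∨' c ≐ S y) ⇔' (y ≐ P c)
≐P-char c y = ∧I (⇛I (∨E hyp c≐0∧y≐0⇒ c≐Sy⇒)) (⇛I (∨E excluded-middle c≐0⇒ c≢0⇒))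
  where
  P-cong : ∀ {Γ a b} → Γ ⊢ a ≐ b → Γ ⊢ P a ≐ P b
  P-cong = ≐-cong P (λ _ _ → refl)
  S-cong : ∀ {Γ a b} → Γ ⊢ a ≐ b → Γ ⊢ S a ≐ S b
  S-cong = ≐-cong S (λ _ _ → refl)
  c≐0∧y≐0⇒ : ∀ {χ} → (c ≐ 𝟎 ∧' y ≐ 𝟎) ∷ χ ∷ Γₚ ⊢ y ≐ P c
  c≐0∧y≐0⇒ = ≐-trans (∧E₂ hyp) (≐-sym (≐-trans (P-cong (∧E₁ hyp)) (weaken₂ ax-A2)))
  c≐Sy⇒ : ∀ {χ} → c ≐ S y ∷ χ ∷ Γₚ ⊢ y ≐ P c
  c≐Sy⇒ = ≐-sym (≐-trans (P-cong hyp) (weaken₂ (ax-A3 y)))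
  c≐0⇒ : c ≐ 𝟎 ∷ y ≐ P c ∷ Γₚ ⊢ (c ≐ 𝟎 ∧' y ≐ 𝟎) ∨' c ≐ S y
  c≐0⇒ = ∨I₁ (∧I hyp (≐-trans (weaken₁ hyp) (≐-trans (P-cong hyp) (weaken₂ ax-A2))))
  c≢0⇒ : Neg (c ≐ 𝟎) ∷ y ≐ P c ∷ Γₚ ⊢ (c ≐ 𝟎 ∧' y ≐ 𝟎) ∨' c ≐ S y
  c≢0⇒ = ∨I₂ (≐-trans (⇛E (weaken₂ (ax-B1 c)) hyp) (S-cong (≐-sym (weaken₁ hyp))))

graph : (ℕ → ℕ) → Term → Term → Form
graph ρ (var n) v = v ≐ var (ρ n)
graph ρ 𝟎       v = v ≐ 𝟎
graph ρ (S t)   v = Ex (graph (suc ∘ ρ) t (var 0) ∧' renT suc v ≐ S (var 0))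
graph ρ (P t)   v = Ex (graph (suc ∘ ρ) t (var 0) ∧'
  ((var 0 ≐ 𝟎 ∧' renT suc v ≐ 𝟎) ∨' var 0 ≐ S (renT suc v)))
graph ρ (t ⊕ u) v = Ex (graph (suc ∘ ρ) t (var 0) ∧'
  Ex (graph (suc ∘ suc ∘ ρ) u (var 0) ∧' renT suc (renT suc v) ≐ var 1 ⊕ var 0))

letG : (ℕ → ℕ) → Term → Form → Form
letG ρ t B = Ex (graph (suc ∘ ρ) t (var 0) ∧' B)

mutual
  graph-correct : ∀ ρ t v → Γₚ ⊢ graph ρ t v ⇔' (v ≐ renT ρ t)
  graph-correct ρ (var n) v = ⇔-refl
  graph-correct ρ 𝟎       v = ⇔-refl
  graph-correct ρ (S t)   v =
    ⇔-≡ (letG-elim ρ t _) (cong (_≐ S (renT ρ t)) (subT-sub0-renT-suc _ v))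
  graph-correct ρ (P t)   v =
    ⇔-trans (⇔-≡ (letG-elim ρ t _) (cong₂ (λ w w′ → (_ ∧' w ≐ 𝟎) ∨' _ ≐ S w′) v↑[a]≡v v↑[a]≡v))
            (≐P-char (renT ρ t) v)
    where
    v↑[a]≡v : subT (sub0 (renT ρ t)) (renT suc v) ≡ v
    v↑[a]≡v = subT-sub0-renT-suc _ v
  graph-correct ρ (t ⊕ u) v =
    ⇔-≡ (⇔-trans (Ex-cong refl (∧-cong ⇔-refl (letG-elim (suc ∘ ρ) u _))) (letG-elim ρ t _))
        (cong₂ (λ w w′ → w ≐ renT ρ t ⊕ w′) v↑↑[b][a]≡v u↑[a]≡u)
    where
    v↑↑[b][a]≡v : subT (sub0 (renT ρ t)) (subT (sub0 (renT (suc ∘ ρ) u)) (renT suc (renT suc v)))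
                  ≡ v
    v↑↑[b][a]≡v = trans (cong (subT _) (subT-sub0-renT-suc _ (renT suc v)))
                        (subT-sub0-renT-suc _ v)
    u↑[a]≡u : subT (sub0 (renT ρ t)) (renT (suc ∘ ρ) u) ≡ renT ρ u
    u↑[a]≡u = trans (cong (subT _) (sym (renT-renT suc ρ u))) (subT-sub0-renT-suc _ (renT ρ u))

  letG-elim : ∀ ρ t B → Γₚ ⊢ letG ρ t B ⇔' B [ renT ρ t ]
  letG-elim ρ t B = one-point refl B (renT ρ t)
    (⇔-≡ (graph-correct (suc ∘ ρ) t (var 0)) (cong (var 0 ≐_) (sym (renT-renT suc ρ t))))

atom : (Term → Term → Form) → Term → Term → Form
atom R t u = letG id t (letG suc u (R (var 1) (var 0)))

atom-correct : ∀ (R : Term → Term → Form) → (∀ σ a b → subF σ (R a b) ≡ R (subT σ a) (subT σ b)) →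
               ∀ t u → Γₚ ⊢ atom R t u ⇔' R t u
atom-correct R R-sub t u =
  ⇔-≡ (⇔-trans (Ex-cong refl (∧-cong ⇔-refl (⇔-≡ (letG-elim suc u _) (R-sub _ (var 1) (var 0)))))
               (letG-elim id t _))
      (trans (R-sub _ (var 0) (renT suc u))
             (cong₂ R (renT-id t) (subT-sub0-renT-suc _ u)))

NoPT-renT : ∀ {t} ρ → NoPT t → NoPT (renT ρ t)
NoPT-renT ρ (var n) = var (ρ n)
NoPT-renT ρ 𝟎       = 𝟎
NoPT-renT ρ (S h)   = S (NoPT-renT ρ h)
NoPT-renT ρ (h ⊕ k) = NoPT-renT ρ h ⊕ NoPT-renT ρ k

NoP-graph : ∀ ρ t {v} → NoPT v → NoP (graph ρ t v)
NoP-graph ρ (var n) h = h ≐ var (ρ n)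
NoP-graph ρ 𝟎       h = h ≐ 𝟎
NoP-graph ρ (S t)   h = Ex (NoP-graph (suc ∘ ρ) t (var 0) ∧' (NoPT-renT suc h ≐ S (var 0)))
NoP-graph ρ (P t)   h = Ex (NoP-graph (suc ∘ ρ) t (var 0) ∧'
  (((var 0 ≐ 𝟎) ∧' (NoPT-renT suc h ≐ 𝟎)) ∨' (var 0 ≐ S (NoPT-renT suc h))))
NoP-graph ρ (t ⊕ u) h = Ex (NoP-graph (suc ∘ ρ) t (var 0) ∧'
  Ex (NoP-graph (suc ∘ suc ∘ ρ) u (var 0) ∧' (NoPT-renT suc (NoPT-renT suc h) ≐ (var 1 ⊕ var 0))))

NoP-atom : ∀ R t u → NoP (R (var 1) (var 0)) → NoP (atom R t u)
NoP-atom R t u h = Ex (NoP-graph (suc ∘ id) t (var 0) ∧' Ex (NoP-graph (suc ∘ suc) u (var 0) ∧' h))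

eliminateP : Form → Form
eliminateP Bot      = Bot
eliminateP (t ≐ u)  = atom _≐_ t u
eliminateP (t ⊳ u)  = atom _⊳_ t u
eliminateP (φ ⇛ ψ)  = eliminateP φ ⇛ eliminateP ψ
eliminateP (φ ∧' ψ) = eliminateP φ ∧' eliminateP ψ
eliminateP (φ ∨' ψ) = eliminateP φ ∨' eliminateP ψ
eliminateP (Fall φ) = Fall (eliminateP φ)
eliminateP (Ex φ)   = Ex (eliminateP φ)

NoP-eliminateP : ∀ φ → NoP (eliminateP φ)
NoP-eliminateP Bot      = Bot
NoP-eliminateP (t ≐ u)  = NoP-atom _≐_ t u (var 1 ≐ var 0)
NoP-eliminateP (t ⊳ u)  = NoP-atom _⊳_ t u (var 1 ⊳ var 0)
NoP-eliminateP (φ ⇛ ψ)  = NoP-eliminateP φ ⇛ NoP-eliminateP ψ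
NoP-eliminateP (φ ∧' ψ) = NoP-eliminateP φ ∧' NoP-eliminateP ψ
NoP-eliminateP (φ ∨' ψ) = NoP-eliminateP φ ∨' NoP-eliminateP ψ
NoP-eliminateP (Fall φ) = Fall (NoP-eliminateP φ)
NoP-eliminateP (Ex φ)   = Ex (NoP-eliminateP φ)

eliminateP-correct : ∀ φ → Γₚ ⊢ φ ⇔' eliminateP φ
eliminateP-correct Bot      = ⇔-refl
eliminateP-correct (t ≐ u)  = ⇔-sym (atom-correct _≐_ (λ _ _ _ → refl) t u)
eliminateP-correct (t ⊳ u)  = ⇔-sym (atom-correct _⊳_ (λ _ _ _ → refl) t u)
eliminateP-correct (φ ⇛ ψ)  = ⇛-cong (eliminateP-correct φ) (eliminateP-correct ψ)
eliminateP-correct (φ ∧' ψ) = ∧-cong (eliminateP-correct φ) (eliminateP-correct ψ)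
eliminateP-correct (φ ∨' ψ) = ∨-cong (eliminateP-correct φ) (eliminateP-correct ψ)
eliminateP-correct (Fall φ) = Fall-cong refl (eliminateP-correct φ)
eliminateP-correct (Ex φ)   = Ex-cong refl (eliminateP-correct φ)

proposition3p6 : (φ : Form) → Σ Form λ ψ → NoP ψ × (TI⊢ (φ ⇔' ψ))
proposition3p6 φ = eliminateP φ , NoP-eliminateP φ , Γₚ , Γₚ-axioms , eliminateP-correct φ
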